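{- Let $R_1,R_2\geq1$ and $v_1,v_2\geq0$ be integers and $u=v_1+v_2+2$. Then $$M_1(R_1,R_2)=\frac{1}{R_1R_2}\frac{(2v_1+1)!\,(2v_2+1)!}{2^{2v_1+2v_2}v_1!\,(v_1+1)!\,v_2!^2}\int_0^1 {}_3F_2\!\left[\begin{matrix}-R_1,\,R_1,\,v_1+\tfrac32\\ \tfrac12,\,v_1+2\end{matrix};\frac x4\right]{}_3F_2\!\left[\begin{matrix}-R_2,\,R_2,\,v_2+\tfrac32\\ \tfrac32,\,v_2+1\end{matrix};\frac x4\right]x^{u-1}\,dx.$$
   Context: For integers $R_1,R_2\geq1$, $v_1,v_2\geq0$, $u=v_1+v_2+2$ and $\nu\in\{1,a,c,ac\}$ (a function of the summation indices), define $$M_\nu(R_1,R_2):=\sum_{a=0}^{R_1}\sum_{c=0}^{R_2}(-1)^{a+c}\frac{(R_1+a-1)!}{(2a)!\,(R_1-a)!}\frac{(R_2+c-1)!}{(2c+1)!\,(R_2-c)!}\cdot\frac{(2v_1+2a+1)!}{2^{2v_1+2a}(v_1+a)!\,(v_1+a+1)!}\cdot\frac{(2v_2+2c+1)!}{2^{2v_2+2c}(v_2+c)!^2}\cdot\frac{\nu}{u+a+c}.$$ The hypergeometric function is ${}_pF_q\!\left[\begin{matrix}a_1,\dots,a_p\\ b_1,\dots,b_q\end{matrix};z\right]=\sum_{k\geq0}\frac{(a_1)_k\cdots(a_p)_k}{k!\,(b_1)_k\cdots(b_q)_k}z^k$, with $(a)_0=1$, $(a)_k=a(a+1)\cdots(a+k-1)$.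 -}

module Defs where

open import Data.Nat as ℕ using (ℕ; zero; suc; _!; _∸_)
open import Data.Integer using (+_)
open import Data.Rational using (ℚ; 0ℚ; 1ℚ; _+_; _*_; -_; 1/_; ≢-nonZero; _/_)
open import Data.Rational.Properties using (_≟_)
open import Data.List using (List; []; _∷_; replicate; map)
open import Relation.Nullary using (yes; no)

ℕ→ℚ : ℕ → ℚ
ℕ→ℚ n = + n / 1

-- total reciprocal (0 ↦ 0); only ever applied to nonzero values below
inv : ℚ → ℚ
inv p with p ≟ 0ℚ
... | yes _  = 0ℚ
... | no p≢0 = 1/_ p {{≢-nonZero p≢0}}

_÷_ : ℚ → ℚ → ℚ
p ÷ q = p * inv q

_^_ : ℚ → ℕ → ℚ
q ^ zero  = 1ℚ
q ^ suc n = q * (q ^ n)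

poch : ℚ → ℕ → ℚ
poch a zero    = 1ℚ
poch a (suc k) = poch a k * (a + ℕ→ℚ k)

sumTo : ℕ → (ℕ → ℚ) → ℚ
sumTo zero    f = f 0
sumTo (suc n) f = sumTo n f + f (suc n)

-- Polynomials in x with rational coefficients (ascending coefficient lists)

Poly : Set
Poly = List ℚ

_+ₚ_ : Poly → Poly → Poly
[]       +ₚ q        = q
p        +ₚ []       = p
(a ∷ p)  +ₚ (b ∷ q)  = (a + b) ∷ (p +ₚ q)

scaleₚ : ℚ → Poly → Poly
scaleₚ c = map (c *_)

_*ₚ_ : Poly → Poly → Poly
[]      *ₚ q = []
(a ∷ p) *ₚ q = scaleₚ a q +ₚ (0ℚ ∷ (p *ₚ q))

xPow : ℕ → Poly
xPow n = replicate n 0ℚ Data.List.++ (1ℚ ∷ [])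
  where import Data.List

∫₀¹-from : ℕ → Poly → ℚ
∫₀¹-from i []      = 0ℚ
∫₀¹-from i (a ∷ p) = a ÷ ℕ→ℚ (suc i) + ∫₀¹-from (suc i) p

∫₀¹ : Poly → ℚ
∫₀¹ = ∫₀¹-from 0

-- Terminating 3F2[-R, a2, a3 ; b1, b2 ; c·x] as a polynomial in x.
-- Since (-R)_k = 0 for k > R, the series is the finite sum over k = 0..R.

hyp3F2coeff : (R : ℕ) (a₂ a₃ b₁ b₂ c : ℚ) → ℕ → ℚ
hyp3F2coeff R a₂ a₃ b₁ b₂ c k =
  (poch (- ℕ→ℚ R) k * poch a₂ k * poch a₃ k * (c ^ k))
    ÷ (ℕ→ℚ (k !) * poch b₁ k * poch b₂ k)

hyp3F2-upto : ℕ → (ℕ → ℚ) → Poly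
hyp3F2-upto zero    f = f 0 ∷ []
hyp3F2-upto (suc n) f = hyp3F2-upto n f +ₚ scaleₚ (f (suc n)) (xPow (suc n))

hyp3F2ₓ : (R : ℕ) (a₂ a₃ b₁ b₂ c : ℚ) → Poly
hyp3F2ₓ R a₂ a₃ b₁ b₂ c = hyp3F2-upto R (hyp3F2coeff R a₂ a₃ b₁ b₂ c)

u : ℕ → ℕ → ℕ
u v₁ v₂ = v₁ ℕ.+ v₂ ℕ.+ 2

sign : ℕ → ℚ
sign n = (- 1ℚ) ^ n

Mterm : (v₁ v₂ R₁ R₂ : ℕ) (ν : ℕ → ℕ → ℚ) → ℕ → ℕ → ℚ
Mterm v₁ v₂ R₁ R₂ ν a c =
  sign (a ℕ.+ c)
  * (ℕ→ℚ ((R₁ ℕ.+ a ∸ 1) !) ÷ ℕ→ℚ ((2 ℕ.* a) ! ℕ.* (R₁ ∸ a) !))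
  * (ℕ→ℚ ((R₂ ℕ.+ c ∸ 1) !) ÷ ℕ→ℚ ((2 ℕ.* c ℕ.+ 1) ! ℕ.* (R₂ ∸ c) !))
  * (ℕ→ℚ ((2 ℕ.* v₁ ℕ.+ 2 ℕ.* a ℕ.+ 1) !)
      ÷ ℕ→ℚ (2 ℕ.^ (2 ℕ.* v₁ ℕ.+ 2 ℕ.* a) ℕ.* (v₁ ℕ.+ a) ! ℕ.* (v₁ ℕ.+ a ℕ.+ 1) !))
  * (ℕ→ℚ ((2 ℕ.* v₂ ℕ.+ 2 ℕ.* c ℕ.+ 1) !)
      ÷ ℕ→ℚ (2 ℕ.^ (2 ℕ.* v₂ ℕ.+ 2 ℕ.* c) ℕ.* (v₂ ℕ.+ c) ! ℕ.* (v₂ ℕ.+ c) !))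
  * (ν a c ÷ ℕ→ℚ (u v₁ v₂ ℕ.+ a ℕ.+ c))

M : (v₁ v₂ : ℕ) (ν : ℕ → ℕ → ℚ) (R₁ R₂ : ℕ) → ℚ
M v₁ v₂ ν R₁ R₂ = sumTo R₁ (λ a → sumTo R₂ (λ c → Mterm v₁ v₂ R₁ R₂ ν a c))

M₁ : (v₁ v₂ R₁ R₂ : ℕ) → ℚ
M₁ v₁ v₂ = M v₁ v₂ (λ _ _ → 1ℚ)

{-# OPTIONS --safe #-}
-- Expanding both terminating ₃F₂ polynomials and integrating term by term, the
-- monomial x^(u-1+a+c) contributes 1/(u+a+c), so the right-hand side is a double sum
-- over (a, c) of the prefactor times the two hypergeometric coefficients times
-- 1/(u+a+c).  It agrees with M₁ term by term: every Pochhammer symbol involved is a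
-- quotient of factorials,
--   (-R)_a = (-1)^a R!/(R-a)!,  (R)_a = (R+a-1)!/(R-1)!,  (w+1)_a = (w+a)!/w!,
--   (1/2)_a = (2a)!/(4^a a!),  (m+3/2)_a = (2m+2a+1)! m!/(4^a (m+a)! (2m+1)!),
-- and each coefficient splits into a part depending on R and a part depending on v,
-- which after cancelling factorials are the two factorial quotients of M₁.
module Submission where

open import Defs
open import Data.Nat using (ℕ; _≥_; _!; _∸_)
open import Data.Integer using (+_)
open import Data.Rational using (ℚ; _+_; _*_; _/_)
open import Relation.Binary.PropositionalEquality using (_≡_)

open import Algebra.Bundles using (CommutativeMonoid)
open import Data.Nat as ℕ using (zero; suc; NonZero; _≤_)
import Data.Nat.Properties as ℕₚ
open import Data.Nat.Tactic.RingSolver using () renaming (solve-∀ to ℕ-solve-∀)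
import Data.Integer as ℤ
import Data.Integer.Properties as ℤₚ
open import Data.Rational using (0ℚ; 1ℚ; -_; ≢-nonZero; toℚᵘ)
import Data.Rational.Properties as ℚₚ
open import Data.Rational.Unnormalised using (mkℚᵘ; *≡*) renaming (_≃_ to _≃ᵘ_)
import Data.Rational.Unnormalised.Properties as ℚᵘₚ
open import Data.List using ([]; _∷_)
open import Relation.Binary.PropositionalEquality
  using (refl; sym; trans; cong; cong₂; subst; subst₂; _≢_; module ≡-Reasoning)
open import Relation.Nullary using (Dec; yes; no; contradiction)
open import Relation.Nullary.Decidable using (dec⇒maybe)
open import Algebra.Properties.CommutativeSemigroup
  (CommutativeMonoid.commutativeSemigroup ℚₚ.*-1-commutativeMonoid) using (interchange)
open import Algebra.Properties.CommutativeSemigroup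
  (CommutativeMonoid.commutativeSemigroup ℚₚ.+-0-commutativeMonoid)
  using () renaming (interchange to +-interchange)
open import Tactic.RingSolver using (solve-∀)
open import Tactic.RingSolver.Core.AlmostCommutativeRing
  using (AlmostCommutativeRing; fromCommutativeRing)
open ≡-Reasoning

ℚ-ring : AlmostCommutativeRing _ _
ℚ-ring = fromCommutativeRing ℚₚ.+-*-commutativeRing (λ x → dec⇒maybe (0ℚ ℚₚ.≟ x))

ℕ→ℚ-toℚᵘ : ∀ n → toℚᵘ (ℕ→ℚ n) ≃ᵘ mkℚᵘ (+ n) 0
ℕ→ℚ-toℚᵘ n = ℚₚ.toℚᵘ-fromℚᵘ (mkℚᵘ (+ n) 0)

ℕ→ℚ-homo-+ : ∀ m n → ℕ→ℚ (m ℕ.+ n) ≡ ℕ→ℚ m + ℕ→ℚ n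
ℕ→ℚ-homo-+ m n = ℚₚ.toℚᵘ-injective (ℚᵘₚ.≃-trans (ℕ→ℚ-toℚᵘ (m ℕ.+ n))
  (ℚᵘₚ.≃-trans (*≡* (cong (ℤ._* + 1) +[m+n]≡m*1+n*1))
  (ℚᵘₚ.≃-sym (ℚᵘₚ.≃-trans (ℚₚ.toℚᵘ-homo-+ (ℕ→ℚ m) (ℕ→ℚ n))
                           (ℚᵘₚ.+-cong (ℕ→ℚ-toℚᵘ m) (ℕ→ℚ-toℚᵘ n))))))
  where
  +[m+n]≡m*1+n*1 : + (m ℕ.+ n) ≡ + m ℤ.* + 1 ℤ.+ + n ℤ.* + 1
  +[m+n]≡m*1+n*1 = trans (ℤₚ.pos-+ m n)
    (sym (cong₂ ℤ._+_ (ℤₚ.*-identityʳ (+ m)) (ℤₚ.*-identityʳ (+ n))))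

ℕ→ℚ-homo-* : ∀ m n → ℕ→ℚ (m ℕ.* n) ≡ ℕ→ℚ m * ℕ→ℚ n
ℕ→ℚ-homo-* m n = ℚₚ.toℚᵘ-injective (ℚᵘₚ.≃-trans (ℕ→ℚ-toℚᵘ (m ℕ.* n))
  (ℚᵘₚ.≃-trans (*≡* (cong (ℤ._* + 1) (ℤₚ.pos-* m n)))
  (ℚᵘₚ.≃-sym (ℚᵘₚ.≃-trans (ℚₚ.toℚᵘ-homo-* (ℕ→ℚ m) (ℕ→ℚ n))
                           (ℚᵘₚ.*-cong (ℕ→ℚ-toℚᵘ m) (ℕ→ℚ-toℚᵘ n))))))

ℕ→ℚ-≢0 : ∀ n .{{_ : NonZero n}} → ℕ→ℚ n ≢ 0ℚ
ℕ→ℚ-≢0 (suc n) eq with ℚᵘₚ.≃-trans (ℚᵘₚ.≃-sym (ℕ→ℚ-toℚᵘ (suc n))) (ℚₚ.toℚᵘ-cong eq)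
... | *≡* ()

inv-inverseʳ : ∀ {x} → x ≢ 0ℚ → x * inv x ≡ 1ℚ
inv-inverseʳ {x} x≢0 with x ℚₚ.≟ 0ℚ
... | yes x≡0  = contradiction x≡0 x≢0
... | no  x≢0′ = ℚₚ.*-inverseʳ x {{≢-nonZero x≢0′}}

inv-unique : ∀ x y → x * y ≡ 1ℚ → inv x ≡ y
inv-unique x y xy≡1 with x ℚₚ.≟ 0ℚ
... | yes refl = contradiction (trans (sym xy≡1) (ℚₚ.*-zeroˡ y)) ℚₚ.1≢0
... | no  x≢0  = begin
  1/x              ≡⟨ ℚₚ.*-identityʳ 1/x ⟨
  1/x * 1ℚ         ≡⟨ cong (1/x *_) xy≡1 ⟨
  1/x * (x * y)    ≡⟨ ℚₚ.*-assoc 1/x x y ⟨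
  (1/x * x) * y    ≡⟨ cong (_* y) (ℚₚ.*-inverseˡ x {{≢-nonZero x≢0}}) ⟩
  1ℚ * y           ≡⟨ ℚₚ.*-identityˡ y ⟩
  y                ∎
  where 1/x = Data.Rational.1/_ x {{≢-nonZero x≢0}}

inv-distrib-* : ∀ x y → inv (x * y) ≡ inv x * inv y
inv-distrib-* x y = cases (x ℚₚ.≟ 0ℚ) (y ℚₚ.≟ 0ℚ)
  where
  cases : Dec (x ≡ 0ℚ) → Dec (y ≡ 0ℚ) → inv (x * y) ≡ inv x * inv y
  cases (yes refl) _ = trans (cong inv (ℚₚ.*-zeroˡ y)) (sym (ℚₚ.*-zeroˡ (inv y)))
  cases (no _) (yes refl) = trans (cong inv (ℚₚ.*-zeroʳ x)) (sym (ℚₚ.*-zeroʳ (inv x)))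
  cases (no x≢0) (no y≢0) = inv-unique (x * y) (inv x * inv y) (begin
    (x * y) * (inv x * inv y)      ≡⟨ interchange x y (inv x) (inv y) ⟩
    (x * inv x) * (y * inv y)      ≡⟨ cong₂ _*_ (inv-inverseʳ x≢0) (inv-inverseʳ y≢0) ⟩
    1ℚ                             ∎)

inv-involutive : ∀ x → inv (inv x) ≡ x
inv-involutive x = cases (x ℚₚ.≟ 0ℚ)
  where
  cases : Dec (x ≡ 0ℚ) → inv (inv x) ≡ x
  cases (yes refl) = refl
  cases (no x≢0)   = inv-unique (inv x) x (trans (ℚₚ.*-comm (inv x) x) (inv-inverseʳ x≢0))

^-distribˡ-+-* : ∀ x m n → x ^ (m ℕ.+ n) ≡ x ^ m * x ^ n
^-distribˡ-+-* x zero    n = sym (ℚₚ.*-identityˡ (x ^ n))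
^-distribˡ-+-* x (suc m) n =
  trans (cong (x *_) (^-distribˡ-+-* x m n)) (sym (ℚₚ.*-assoc x (x ^ m) (x ^ n)))

ℕ→ℚ-homo-^ : ∀ m n → ℕ→ℚ (m ℕ.^ n) ≡ ℕ→ℚ m ^ n
ℕ→ℚ-homo-^ m zero    = refl
ℕ→ℚ-homo-^ m (suc n) = trans (ℕ→ℚ-homo-* m (m ℕ.^ n)) (cong (ℕ→ℚ m *_) (ℕ→ℚ-homo-^ m n))

inv-^ : ∀ x n → inv x ^ n ≡ inv (x ^ n)
inv-^ x zero    = refl
inv-^ x (suc n) = trans (cong (inv x *_) (inv-^ x n)) (sym (inv-distrib-* x (x ^ n)))

÷-*-÷ : ∀ a b c d → (a ÷ b) * (c ÷ d) ≡ (a * c) ÷ (b * d)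
÷-*-÷ a b c d =
  trans (interchange a (inv b) c (inv d)) (cong ((a * c) *_) (sym (inv-distrib-* b d)))

÷-÷-÷ : ∀ a b c d → (a ÷ b) ÷ (c ÷ d) ≡ (a * d) ÷ (b * c)
÷-÷-÷ a b c d = begin
  (a ÷ b) * inv (c * inv d)          ≡⟨ cong ((a ÷ b) *_) (inv-distrib-* c (inv d)) ⟩
  (a ÷ b) * (inv c * inv (inv d))    ≡⟨ cong (λ z → (a ÷ b) * (inv c * z)) (inv-involutive d) ⟩
  (a ÷ b) * (inv c * d)              ≡⟨ cong ((a ÷ b) *_) (ℚₚ.*-comm (inv c) d) ⟩
  (a ÷ b) * (d ÷ c)                  ≡⟨ ÷-*-÷ a b d c ⟩
  (a * d) ÷ (b * c)                  ∎

÷-cancelʳ : ∀ {k} → k ≢ 0ℚ → ∀ a b → (a * k) ÷ (b * k) ≡ a ÷ b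
÷-cancelʳ {k} k≢0 a b = begin
  (a * k) ÷ (b * k)    ≡⟨ ÷-*-÷ a b k k ⟨
  (a ÷ b) * (k ÷ k)    ≡⟨ cong ((a ÷ b) *_) (inv-inverseʳ k≢0) ⟩
  (a ÷ b) * 1ℚ         ≡⟨ ℚₚ.*-identityʳ (a ÷ b) ⟩
  a ÷ b                ∎

x*d≡y⇒x≡y÷d : ∀ {x y d} → d ≢ 0ℚ → x * d ≡ y → x ≡ y ÷ d
x*d≡y⇒x≡y÷d {x} {y} {d} d≢0 x*d≡y = begin
  x                  ≡⟨ ℚₚ.*-identityʳ x ⟨
  x * 1ℚ             ≡⟨ cong (x *_) (inv-inverseʳ d≢0) ⟨
  x * (d * inv d)    ≡⟨ ℚₚ.*-assoc x d (inv d) ⟨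
  (x * d) * inv d    ≡⟨ cong (_* inv d) x*d≡y ⟩
  y ÷ d              ∎

ℕ→ℚ-÷-homo-* : ∀ a b c d → ℕ→ℚ (a ℕ.* c) ÷ ℕ→ℚ (b ℕ.* d) ≡ (ℕ→ℚ a * ℕ→ℚ c) ÷ (ℕ→ℚ b * ℕ→ℚ d)
ℕ→ℚ-÷-homo-* a b c d = cong₂ _÷_ (ℕ→ℚ-homo-* a c) (ℕ→ℚ-homo-* b d)

ℕ→ℚ-÷-*-÷ : ∀ a b c d → (ℕ→ℚ a ÷ ℕ→ℚ b) * (ℕ→ℚ c ÷ ℕ→ℚ d) ≡ ℕ→ℚ (a ℕ.* c) ÷ ℕ→ℚ (b ℕ.* d)
ℕ→ℚ-÷-*-÷ a b c d = trans (÷-*-÷ (ℕ→ℚ a) (ℕ→ℚ b) (ℕ→ℚ c) (ℕ→ℚ d)) (sym (ℕ→ℚ-÷-homo-* a b c d))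

infix 4 _≐_⁄_

-- Both parts are kept positive so that quotients of ratios can be cancelled, inv being
-- total with inv 0ℚ = 0ℚ.
record _≐_⁄_ (x : ℚ) (n d : ℕ) : Set where
  constructor ratio
  field
    .{{num≢0}} : NonZero n
    .{{den≢0}} : NonZero d
    eq         : x ≡ ℕ→ℚ n ÷ ℕ→ℚ d

x*d≡n⇒x≐n⁄d : ∀ {x n d} .{{_ : NonZero n}} .{{_ : NonZero d}} → x * ℕ→ℚ d ≡ ℕ→ℚ n → x ≐ n ⁄ d
x*d≡n⇒x≐n⁄d {d = d} x*d≡n = ratio (x*d≡y⇒x≡y÷d (ℕ→ℚ-≢0 d) x*d≡n)

ℕ→ℚ≐n⁄1 : ∀ n .{{_ : NonZero n}} → ℕ→ℚ n ≐ n ⁄ 1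
ℕ→ℚ≐n⁄1 n = ratio (sym (ℚₚ.*-identityʳ (ℕ→ℚ n)))

*-≐ : ∀ {x y a b c d} → x ≐ a ⁄ b → y ≐ c ⁄ d → x * y ≐ a ℕ.* c ⁄ b ℕ.* d
*-≐ {a = a} {b} {c} {d} (ratio refl) (ratio refl) =
  ratio {{ℕₚ.m*n≢0 a c}} {{ℕₚ.m*n≢0 b d}} (ℕ→ℚ-÷-*-÷ a b c d)

÷-≐ : ∀ {x y a b c d} → x ≐ a ⁄ b → y ≐ c ⁄ d → x ÷ y ≐ a ℕ.* d ⁄ b ℕ.* c
÷-≐ {a = a} {b} {c} {d} (ratio refl) (ratio refl) =
  ratio {{ℕₚ.m*n≢0 a d}} {{ℕₚ.m*n≢0 b c}}
    (trans (÷-÷-÷ (ℕ→ℚ a) (ℕ→ℚ b) (ℕ→ℚ c) (ℕ→ℚ d)) (sym (ℕ→ℚ-÷-homo-* a b d c)))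

≐-cross : ∀ {x a b c d} .{{_ : NonZero c}} → x ≐ a ⁄ b → a ℕ.* d ≡ c ℕ.* b → x ≡ ℕ→ℚ c ÷ ℕ→ℚ d
≐-cross {a = a} {b} {c} {d} (ratio refl) ad≡cb = begin
  ℕ→ℚ a ÷ ℕ→ℚ b                          ≡⟨ ÷-cancelʳ (ℕ→ℚ-≢0 d) (ℕ→ℚ a) (ℕ→ℚ b) ⟨
  (ℕ→ℚ a * ℕ→ℚ d) ÷ (ℕ→ℚ b * ℕ→ℚ d)      ≡⟨ ℕ→ℚ-÷-homo-* a b d d ⟨
  ℕ→ℚ (a ℕ.* d) ÷ ℕ→ℚ (b ℕ.* d)          ≡⟨ cong₂ (λ p q → ℕ→ℚ p ÷ ℕ→ℚ q) ad≡cb (ℕₚ.*-comm b d) ⟩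
  ℕ→ℚ (c ℕ.* b) ÷ ℕ→ℚ (d ℕ.* b)          ≡⟨ ℕ→ℚ-÷-homo-* c d b b ⟩
  (ℕ→ℚ c * ℕ→ℚ b) ÷ (ℕ→ℚ d * ℕ→ℚ b)      ≡⟨ ÷-cancelʳ (ℕ→ℚ-≢0 b) (ℕ→ℚ c) (ℕ→ℚ d) ⟩
  ℕ→ℚ c ÷ ℕ→ℚ d                          ∎
  where
  instance
    d≢0 : NonZero d
    d≢0 = ℕₚ.m*n≢0⇒n≢0 a {{subst NonZero (sym ad≡cb) (ℕₚ.m*n≢0 c b)}}

¼^a≐1⁄4^a : ∀ a → (+ 1 / 4) ^ a ≐ 1 ⁄ 4 ℕ.^ a
¼^a≐1⁄4^a a = ratio {{_}} {{ℕₚ.m^n≢0 4 a}} (begin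
  inv (ℕ→ℚ 4) ^ a        ≡⟨ inv-^ (ℕ→ℚ 4) a ⟩
  inv (ℕ→ℚ 4 ^ a)        ≡⟨ cong inv (ℕ→ℚ-homo-^ 4 a) ⟨
  inv (ℕ→ℚ (4 ℕ.^ a))    ≡⟨ ℚₚ.*-identityˡ (inv (ℕ→ℚ (4 ℕ.^ a))) ⟨
  1ℚ ÷ ℕ→ℚ (4 ℕ.^ a)     ∎)

sumTo-cong : ∀ n {f g} → (∀ i → i ≤ n → f i ≡ g i) → sumTo n f ≡ sumTo n g
sumTo-cong zero    f≗g = f≗g 0 ℕ.z≤n
sumTo-cong (suc n) f≗g =
  cong₂ _+_ (sumTo-cong n λ i i≤n → f≗g i (ℕₚ.m≤n⇒m≤1+n i≤n)) (f≗g (suc n) ℕₚ.≤-refl)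

*-distribˡ-sumTo : ∀ c n f → c * sumTo n f ≡ sumTo n (λ i → c * f i)
*-distribˡ-sumTo c zero    f = refl
*-distribˡ-sumTo c (suc n) f =
  trans (ℚₚ.*-distribˡ-+ c (sumTo n f) (f (suc n))) (cong (_+ c * f (suc n)) (*-distribˡ-sumTo c n f))

-- Pochhammer symbols

poch-suc : ∀ x a → poch x (suc a) ≡ x * poch (x + 1ℚ) a
poch-suc x zero    = 1*[x+0]≡x*1 x
  where
  1*[x+0]≡x*1 : ∀ x → 1ℚ * (x + 0ℚ) ≡ x * 1ℚ
  1*[x+0]≡x*1 = solve-∀ ℚ-ring
poch-suc x (suc a) = begin
  poch x (suc a) * (x + ℕ→ℚ (suc a))
    ≡⟨ cong₂ _*_ (poch-suc x a) x+[1+a]≡[x+1]+a ⟩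
  (x * poch (x + 1ℚ) a) * ((x + 1ℚ) + ℕ→ℚ a)
    ≡⟨ ℚₚ.*-assoc x (poch (x + 1ℚ) a) _ ⟩
  x * poch (x + 1ℚ) (suc a) ∎
  where
  x+[1+a]≡[x+1]+a : x + ℕ→ℚ (suc a) ≡ (x + 1ℚ) + ℕ→ℚ a
  x+[1+a]≡[x+1]+a = trans (cong (λ y → x + y) (ℕ→ℚ-homo-+ 1 a)) (sym (ℚₚ.+-assoc x 1ℚ (ℕ→ℚ a)))

poch-neg : ∀ a m → poch (- ℕ→ℚ (a ℕ.+ m)) a * ℕ→ℚ (m !) ≡ sign a * ℕ→ℚ ((a ℕ.+ m) !)
poch-neg zero    m = refl
poch-neg (suc a) m = begin
  poch (- n) (suc a) * ℕ→ℚ (m !)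
    ≡⟨ cong (_* ℕ→ℚ (m !)) (poch-suc (- n) a) ⟩
  (- n * poch (- n + 1ℚ) a) * ℕ→ℚ (m !)
    ≡⟨ cong (λ y → (- n * poch y a) * ℕ→ℚ (m !)) -n+1≡-[n-1] ⟩
  (- n * poch (- ℕ→ℚ (a ℕ.+ m)) a) * ℕ→ℚ (m !)
    ≡⟨ ℚₚ.*-assoc (- n) _ (ℕ→ℚ (m !)) ⟩
  - n * (poch (- ℕ→ℚ (a ℕ.+ m)) a * ℕ→ℚ (m !))
    ≡⟨ cong (- n *_) (poch-neg a m) ⟩
  - n * (sign a * ℕ→ℚ ((a ℕ.+ m) !))
    ≡⟨ -x*[s*y]≡[-1*s]*[x*y] n (sign a) (ℕ→ℚ ((a ℕ.+ m) !)) ⟩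
  sign (suc a) * (n * ℕ→ℚ ((a ℕ.+ m) !))
    ≡⟨ cong (sign (suc a) *_) (ℕ→ℚ-homo-* (suc (a ℕ.+ m)) ((a ℕ.+ m) !)) ⟨
  sign (suc a) * ℕ→ℚ ((suc a ℕ.+ m) !) ∎
  where
  n = ℕ→ℚ (suc a ℕ.+ m)
  -[1+y]+1≡-y : ∀ y → - (1ℚ + y) + 1ℚ ≡ - y
  -[1+y]+1≡-y = solve-∀ ℚ-ring
  -n+1≡-[n-1] : - n + 1ℚ ≡ - ℕ→ℚ (a ℕ.+ m)
  -n+1≡-[n-1] = trans (cong (λ y → - y + 1ℚ) (ℕ→ℚ-homo-+ 1 (a ℕ.+ m))) (-[1+y]+1≡-y _)
  -x*[s*y]≡[-1*s]*[x*y] : ∀ x s y → - x * (s * y) ≡ (- 1ℚ * s) * (x * y)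
  -x*[s*y]≡[-1*s]*[x*y] = solve-∀ ℚ-ring

module _ (x : ℚ) (D N δ ν : ℕ → ℕ) (D₀≡N₀ : D 0 ≡ N 0)
         (D-step : ∀ a → D (suc a) ≡ D a ℕ.* δ a)
         (N-step : ∀ a → N (suc a) ≡ N a ℕ.* ν a)
         (factor : ∀ a → (x + ℕ→ℚ a) * ℕ→ℚ (δ a) ≡ ℕ→ℚ (ν a)) where

  poch-telescope : ∀ a → poch x a * ℕ→ℚ (D a) ≡ ℕ→ℚ (N a)
  poch-telescope zero    = trans (ℚₚ.*-identityˡ (ℕ→ℚ (D 0))) (cong ℕ→ℚ D₀≡N₀)
  poch-telescope (suc a) = begin
    (poch x a * (x + ℕ→ℚ a)) * ℕ→ℚ (D (suc a))
      ≡⟨ cong (poch x a * (x + ℕ→ℚ a) *_) (trans (cong ℕ→ℚ (D-step a)) (ℕ→ℚ-homo-* (D a) (δ a))) ⟩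
    (poch x a * (x + ℕ→ℚ a)) * (ℕ→ℚ (D a) * ℕ→ℚ (δ a))
      ≡⟨ interchange (poch x a) (x + ℕ→ℚ a) (ℕ→ℚ (D a)) (ℕ→ℚ (δ a)) ⟩
    (poch x a * ℕ→ℚ (D a)) * ((x + ℕ→ℚ a) * ℕ→ℚ (δ a))
      ≡⟨ cong₂ _*_ (poch-telescope a) (factor a) ⟩
    ℕ→ℚ (N a) * ℕ→ℚ (ν a)
      ≡⟨ trans (cong ℕ→ℚ (N-step a)) (ℕ→ℚ-homo-* (N a) (ν a)) ⟨
    ℕ→ℚ (N (suc a)) ∎

poch-rising : ∀ m a → poch (ℕ→ℚ (suc m)) a ≐ (m ℕ.+ a) ! ⁄ m !
poch-rising m a = x*d≡n⇒x≐n⁄d {{(m ℕ.+ a) ℕₚ.!≢0}} {{m ℕₚ.!≢0}}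
  (poch-telescope (ℕ→ℚ (suc m)) (λ _ → m !) (λ a → (m ℕ.+ a) !) (λ _ → 1) (λ a → suc (m ℕ.+ a))
    (cong _! (sym (ℕₚ.+-identityʳ m)))
    (λ _ → sym (ℕₚ.*-identityʳ (m !)))
    (λ a → trans (cong _! (ℕₚ.+-suc m a)) (ℕₚ.*-comm (suc (m ℕ.+ a)) ((m ℕ.+ a) !)))
    (λ a → trans (ℚₚ.*-identityʳ _) (sym (ℕ→ℚ-homo-+ (suc m) a)))
    a)

[½+k]*2n≡[1+2k]*n : ∀ k n → (+ 1 / 2 + ℕ→ℚ k) * ℕ→ℚ (2 ℕ.* n) ≡ ℕ→ℚ (suc (2 ℕ.* k) ℕ.* n)
[½+k]*2n≡[1+2k]*n k n = begin
  (+ 1 / 2 + ℕ→ℚ k) * ℕ→ℚ (2 ℕ.* n)        ≡⟨ cong ((+ 1 / 2 + ℕ→ℚ k) *_) (ℕ→ℚ-homo-* 2 n) ⟩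
  (+ 1 / 2 + ℕ→ℚ k) * (ℕ→ℚ 2 * ℕ→ℚ n)      ≡⟨ ℚₚ.*-assoc (+ 1 / 2 + ℕ→ℚ k) (ℕ→ℚ 2) (ℕ→ℚ n) ⟨
  ((+ 1 / 2 + ℕ→ℚ k) * ℕ→ℚ 2) * ℕ→ℚ n      ≡⟨ cong (_* ℕ→ℚ n) ([½+y]*2≡1+2*y (ℕ→ℚ k)) ⟩
  (1ℚ + ℕ→ℚ 2 * ℕ→ℚ k) * ℕ→ℚ n             ≡⟨ cong (_* ℕ→ℚ n) (trans (ℕ→ℚ-homo-+ 1 (2 ℕ.* k)) (cong (λ y → 1ℚ + y) (ℕ→ℚ-homo-* 2 k))) ⟨
  ℕ→ℚ (suc (2 ℕ.* k)) * ℕ→ℚ n               ≡⟨ ℕ→ℚ-homo-* (suc (2 ℕ.* k)) n ⟨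
  ℕ→ℚ (suc (2 ℕ.* k) ℕ.* n)                 ∎
  where
  [½+y]*2≡1+2*y : ∀ y → (+ 1 / 2 + y) * ℕ→ℚ 2 ≡ 1ℚ + ℕ→ℚ 2 * y
  [½+y]*2≡1+2*y = solve-∀ ℚ-ring

poch-½ : ∀ a → poch (+ 1 / 2) a ≐ (2 ℕ.* a) ! ⁄ 4 ℕ.^ a ℕ.* a !
poch-½ a = x*d≡n⇒x≐n⁄d {{(2 ℕ.* a) ℕₚ.!≢0}} {{ℕₚ.m*n≢0 (4 ℕ.^ a) (a !) {{ℕₚ.m^n≢0 4 a}} {{a ℕₚ.!≢0}}}}
  (poch-telescope (+ 1 / 2) (λ a → 4 ℕ.^ a ℕ.* a !) (λ a → (2 ℕ.* a) !)
    (λ a → 2 ℕ.* (2 ℕ.* suc a)) (λ a → suc (2 ℕ.* a) ℕ.* (2 ℕ.* suc a))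
    refl
    (λ a → D-step (4 ℕ.^ a) (a !) a)
    (λ a → trans (cong _! (ℕₚ.*-suc 2 a)) (N-step a ((2 ℕ.* a) !)))
    (λ a → [½+k]*2n≡[1+2k]*n a (2 ℕ.* suc a))
    a)
  where
  D-step : ∀ p f a → 4 ℕ.* p ℕ.* (suc a ℕ.* f) ≡ p ℕ.* f ℕ.* (2 ℕ.* (2 ℕ.* suc a))
  D-step = ℕ-solve-∀
  N-step : ∀ a f → suc (suc (2 ℕ.* a)) ℕ.* (suc (2 ℕ.* a) ℕ.* f) ≡ f ℕ.* (suc (2 ℕ.* a) ℕ.* (2 ℕ.* suc a))
  N-step = ℕ-solve-∀

poch-3/2+m : ∀ m a → poch (ℕ→ℚ m + + 3 / 2) a
                     ≐ (2 ℕ.* m ℕ.+ 2 ℕ.* a ℕ.+ 1) ! ℕ.* m ! ⁄ 4 ℕ.^ a ℕ.* (m ℕ.+ a) ! ℕ.* (2 ℕ.* m ℕ.+ 1) !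
poch-3/2+m m a = x*d≡n⇒x≐n⁄d {{(2 ℕ.* m ℕ.+ 2 ℕ.* a ℕ.+ 1) ℕₚ.!* m !≢0}} {{D≢0}}
  (poch-telescope (ℕ→ℚ m + + 3 / 2)
    (λ a → 4 ℕ.^ a ℕ.* (m ℕ.+ a) ! ℕ.* (2 ℕ.* m ℕ.+ 1) !) (λ a → (2 ℕ.* m ℕ.+ 2 ℕ.* a ℕ.+ 1) ! ℕ.* m !)
    (λ a → 2 ℕ.* (2 ℕ.* suc (m ℕ.+ a))) (λ a → suc (2 ℕ.* suc (m ℕ.+ a)) ℕ.* (2 ℕ.* suc (m ℕ.+ a)))
    (trans (cong₂ (λ k l → 1 ℕ.* k ! ℕ.* (l ℕ.+ 1) !) (ℕₚ.+-identityʳ m) (sym (ℕₚ.+-identityʳ (2 ℕ.* m))))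
           (1*f*g≡g*f (m !) _))
    (λ a → trans (cong (λ k → 4 ℕ.* 4 ℕ.^ a ℕ.* k ! ℕ.* (2 ℕ.* m ℕ.+ 1) !) (ℕₚ.+-suc m a))
                 (D-step (4 ℕ.^ a) (m ℕ.+ a) ((m ℕ.+ a) !) ((2 ℕ.* m ℕ.+ 1) !)))
    (λ a → trans (cong (λ k → k ! ℕ.* m !) (2m+2[1+a]+1≡2+[2m+2a+1] m a))
                 (N-step m a ((2 ℕ.* m ℕ.+ 2 ℕ.* a ℕ.+ 1) !) (m !)))
    (λ a → trans (cong (_* ℕ→ℚ (2 ℕ.* (2 ℕ.* suc (m ℕ.+ a)))) (m+3/2+a≡½+[1+m+a] a))
                 ([½+k]*2n≡[1+2k]*n (suc (m ℕ.+ a)) (2 ℕ.* suc (m ℕ.+ a))))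
    a)
  where
  D≢0 : NonZero (4 ℕ.^ a ℕ.* (m ℕ.+ a) ! ℕ.* (2 ℕ.* m ℕ.+ 1) !)
  D≢0 = ℕₚ.m*n≢0 (4 ℕ.^ a ℕ.* (m ℕ.+ a) !) ((2 ℕ.* m ℕ.+ 1) !)
          {{ℕₚ.m*n≢0 (4 ℕ.^ a) ((m ℕ.+ a) !) {{ℕₚ.m^n≢0 4 a}} {{(m ℕ.+ a) ℕₚ.!≢0}}}} {{(2 ℕ.* m ℕ.+ 1) ℕₚ.!≢0}}
  1*f*g≡g*f : ∀ f g → 1 ℕ.* f ℕ.* g ≡ g ℕ.* f
  1*f*g≡g*f = ℕ-solve-∀
  D-step : ∀ p k f g → 4 ℕ.* p ℕ.* (suc k ℕ.* f) ℕ.* g ≡ p ℕ.* f ℕ.* g ℕ.* (2 ℕ.* (2 ℕ.* suc k))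
  D-step = ℕ-solve-∀
  2m+2[1+a]+1≡2+[2m+2a+1] : ∀ m a → 2 ℕ.* m ℕ.+ 2 ℕ.* suc a ℕ.+ 1 ≡ suc (suc (2 ℕ.* m ℕ.+ 2 ℕ.* a ℕ.+ 1))
  2m+2[1+a]+1≡2+[2m+2a+1] = ℕ-solve-∀
  N-step : ∀ m a f g → let j = 2 ℕ.* m ℕ.+ 2 ℕ.* a ℕ.+ 1 in
           suc (suc j) ℕ.* (suc j ℕ.* f) ℕ.* g ≡ f ℕ.* g ℕ.* (suc (2 ℕ.* suc (m ℕ.+ a)) ℕ.* (2 ℕ.* suc (m ℕ.+ a)))
  N-step = ℕ-solve-∀
  y+3/2+z≡½+[1+[y+z]] : ∀ y z → y + + 3 / 2 + z ≡ + 1 / 2 + (1ℚ + (y + z))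
  y+3/2+z≡½+[1+[y+z]] = solve-∀ ℚ-ring
  m+3/2+a≡½+[1+m+a] : ∀ a → ℕ→ℚ m + + 3 / 2 + ℕ→ℚ a ≡ + 1 / 2 + ℕ→ℚ (suc (m ℕ.+ a))
  m+3/2+a≡½+[1+m+a] a = trans (y+3/2+z≡½+[1+[y+z]] (ℕ→ℚ m) (ℕ→ℚ a))
    (sym (cong (λ y → + 1 / 2 + y) (trans (ℕ→ℚ-homo-+ 1 (m ℕ.+ a)) (cong (λ y → 1ℚ + y) (ℕ→ℚ-homo-+ m a)))))

hyp3F2coeff-split : ∀ R a₂ a₃ b₁ b₂ c k → hyp3F2coeff R a₂ a₃ b₁ b₂ c k ≡
  ((poch (- ℕ→ℚ R) k * poch a₂ k * c ^ k) ÷ (ℕ→ℚ (k !) * poch b₁ k)) * (poch a₃ k ÷ poch b₂ k)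
hyp3F2coeff-split R a₂ a₃ b₁ b₂ c k = begin
  (p₁ * p₂ * p₃ * cᵏ) * inv (k! * q₁ * q₂)
    ≡⟨ cong (p₁ * p₂ * p₃ * cᵏ *_) (inv-distrib-* (k! * q₁) q₂) ⟩
  (p₁ * p₂ * p₃ * cᵏ) * (inv (k! * q₁) * inv q₂)
    ≡⟨ regroup p₁ p₂ p₃ cᵏ (inv (k! * q₁)) (inv q₂) ⟩
  ((p₁ * p₂ * cᵏ) * inv (k! * q₁)) * (p₃ * inv q₂) ∎
  where
  p₁ = poch (- ℕ→ℚ R) k
  p₂ = poch a₂ k
  p₃ = poch a₃ k
  cᵏ = c ^ k
  k! = ℕ→ℚ (k !)
  q₁ = poch b₁ k
  q₂ = poch b₂ k
  regroup : ∀ p₁ p₂ p₃ c i j → (p₁ * p₂ * p₃ * c) * (i * j) ≡ ((p₁ * p₂ * c) * i) * (p₃ * j)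
  regroup = solve-∀ ℚ-ring

hyp3F2coeff-R-part : ∀ r a → a ≤ suc r → ∀ {b n} → poch b a ≐ n ⁄ 4 ℕ.^ a ℕ.* a ! →
  (ℕ→ℚ 1 ÷ ℕ→ℚ (suc r))
    * ((poch (- ℕ→ℚ (suc r)) a * poch (ℕ→ℚ (suc r)) a * (+ 1 / 4) ^ a) ÷ (ℕ→ℚ (a !) * poch b a))
  ≡ sign a * (ℕ→ℚ ((r ℕ.+ a) !) ÷ ℕ→ℚ (n ℕ.* (suc r ∸ a) !))
hyp3F2coeff-R-part r a a≤1+r {b} {n} pochb = begin
  ρ * ((P₋ * P₊ * q) ÷ den)
    ≡⟨ cong (λ p → ρ * ((p * P₊ * q) ÷ den)) P₋≡ ⟩
  ρ * ((sign a * (ℕ→ℚ (suc r !) ÷ ℕ→ℚ (m !)) * P₊ * q) ÷ den)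
    ≡⟨ pull-sign ρ (sign a) (ℕ→ℚ (suc r !) ÷ ℕ→ℚ (m !)) P₊ q (inv den) ⟩
  sign a * (ρ * (((ℕ→ℚ (suc r !) ÷ ℕ→ℚ (m !)) * P₊ * q) ÷ den))
    ≡⟨ cong (sign a *_) (≐-cross {{(r ℕ.+ a) ℕₚ.!≢0}}
          (*-≐ ρ≐ (÷-≐ (*-≐ (*-≐ R!⁄m!≐ (poch-rising r a)) (¼^a≐1⁄4^a a)) (*-≐ (ℕ→ℚ≐n⁄1 (a !) {{a ℕₚ.!≢0}}) pochb)))
          (cancel r (r !) ((r ℕ.+ a) !) (m !) (4 ℕ.^ a) (a !) n)) ⟩
  sign a * (ℕ→ℚ ((r ℕ.+ a) !) ÷ ℕ→ℚ (n ℕ.* m !)) ∎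
  where
  m = suc r ∸ a
  ρ = ℕ→ℚ 1 ÷ ℕ→ℚ (suc r)
  P₋ = poch (- ℕ→ℚ (suc r)) a
  P₊ = poch (ℕ→ℚ (suc r)) a
  q = (+ 1 / 4) ^ a
  den = ℕ→ℚ (a !) * poch b a
  P₋≡ : P₋ ≡ sign a * (ℕ→ℚ (suc r !) ÷ ℕ→ℚ (m !))
  P₋≡ = trans (x*d≡y⇒x≡y÷d (ℕ→ℚ-≢0 (m !) {{m ℕₚ.!≢0}})
                (subst (λ R → poch (- ℕ→ℚ R) a * ℕ→ℚ (m !) ≡ sign a * ℕ→ℚ (R !))
                       (ℕₚ.m+[n∸m]≡n a≤1+r) (poch-neg a m)))
              (ℚₚ.*-assoc (sign a) _ _)
  ρ≐ : ρ ≐ 1 ⁄ suc r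
  ρ≐ = ratio refl
  R!⁄m!≐ : ℕ→ℚ (suc r !) ÷ ℕ→ℚ (m !) ≐ suc r ! ⁄ m !
  R!⁄m!≐ = ratio {{suc r ℕₚ.!≢0}} {{m ℕₚ.!≢0}} refl
  pull-sign : ∀ u s x y z t → u * (((s * x) * y * z) * t) ≡ s * (u * ((x * y * z) * t))
  pull-sign = solve-∀ ℚ-ring
  cancel : ∀ r f k g p h n →
           1 ℕ.* ((suc r ℕ.* f ℕ.* k ℕ.* 1) ℕ.* (1 ℕ.* (p ℕ.* h))) ℕ.* (n ℕ.* g)
           ≡ k ℕ.* (suc r ℕ.* ((g ℕ.* f ℕ.* p) ℕ.* (h ℕ.* n)))
  cancel = ℕ-solve-∀

κ : ℕ → ℕ → ℚ
κ v w = ℕ→ℚ ((2 ℕ.* v ℕ.+ 1) !) ÷ ℕ→ℚ (2 ℕ.^ (2 ℕ.* v) ℕ.* v ! ℕ.* w !)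

hyp3F2coeff-v-part : ∀ v a {b} w w′ → poch b a ≐ w′ ! ⁄ w ! →
  κ v w * (poch (ℕ→ℚ v + + 3 / 2) a ÷ poch b a)
  ≡ ℕ→ℚ ((2 ℕ.* v ℕ.+ 2 ℕ.* a ℕ.+ 1) !) ÷ ℕ→ℚ (2 ℕ.^ (2 ℕ.* v ℕ.+ 2 ℕ.* a) ℕ.* (v ℕ.+ a) ! ℕ.* w′ !)
hyp3F2coeff-v-part v a w w′ pochb =
  ≐-cross {{(2 ℕ.* v ℕ.+ 2 ℕ.* a ℕ.+ 1) ℕₚ.!≢0}} (*-≐ κ≐ (÷-≐ (poch-3/2+m v a) pochb))
    (trans (cong (λ p → (2 ℕ.* v ℕ.+ 1) ! ℕ.* (((2 ℕ.* v ℕ.+ 2 ℕ.* a ℕ.+ 1) ! ℕ.* v !) ℕ.* w !) ℕ.* (p ℕ.* (v ℕ.+ a) ! ℕ.* w′ !))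
                 2^[2v+2a]≡2^2v*4^a)
           (cancel ((2 ℕ.* v ℕ.+ 1) !) ((2 ℕ.* v ℕ.+ 2 ℕ.* a ℕ.+ 1) !) (v !) (w !)
                   (2 ℕ.^ (2 ℕ.* v)) (4 ℕ.^ a) ((v ℕ.+ a) !) (w′ !)))
  where
  κ≐ : κ v w ≐ (2 ℕ.* v ℕ.+ 1) ! ⁄ 2 ℕ.^ (2 ℕ.* v) ℕ.* v ! ℕ.* w !
  κ≐ = ratio {{(2 ℕ.* v ℕ.+ 1) ℕₚ.!≢0}}
             {{ℕₚ.m*n≢0 (2 ℕ.^ (2 ℕ.* v) ℕ.* v !) (w !)
                 {{ℕₚ.m*n≢0 (2 ℕ.^ (2 ℕ.* v)) (v !) {{ℕₚ.m^n≢0 2 (2 ℕ.* v)}} {{v ℕₚ.!≢0}}}} {{w ℕₚ.!≢0}}}}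
             refl
  2^[2v+2a]≡2^2v*4^a : 2 ℕ.^ (2 ℕ.* v ℕ.+ 2 ℕ.* a) ≡ 2 ℕ.^ (2 ℕ.* v) ℕ.* 4 ℕ.^ a
  2^[2v+2a]≡2^2v*4^a = trans (ℕₚ.^-distribˡ-+-* 2 (2 ℕ.* v) (2 ℕ.* a))
                              (cong (2 ℕ.^ (2 ℕ.* v) ℕ.*_) (sym (ℕₚ.^-*-assoc 2 2 a)))
  cancel : ∀ t k x y p q z y′ →
           t ℕ.* ((k ℕ.* x) ℕ.* y) ℕ.* (p ℕ.* q ℕ.* z ℕ.* y′)
           ≡ k ℕ.* ((p ℕ.* x ℕ.* y) ℕ.* ((q ℕ.* z ℕ.* t) ℕ.* y′))
  cancel = ℕ-solve-∀

hyp3F2coeff-factor : ∀ r v a → a ≤ suc r → ∀ {b₁ b₂ n} w w′ →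
  poch b₁ a ≐ n ⁄ 4 ℕ.^ a ℕ.* a ! → poch b₂ a ≐ w′ ! ⁄ w ! →
  ((ℕ→ℚ 1 ÷ ℕ→ℚ (suc r)) * κ v w)
    * hyp3F2coeff (suc r) (ℕ→ℚ (suc r)) (ℕ→ℚ v + + 3 / 2) b₁ b₂ (+ 1 / 4) a
  ≡ sign a * (ℕ→ℚ ((r ℕ.+ a) !) ÷ ℕ→ℚ (n ℕ.* (suc r ∸ a) !))
      * (ℕ→ℚ ((2 ℕ.* v ℕ.+ 2 ℕ.* a ℕ.+ 1) !) ÷ ℕ→ℚ (2 ℕ.^ (2 ℕ.* v ℕ.+ 2 ℕ.* a) ℕ.* (v ℕ.+ a) ! ℕ.* w′ !))
hyp3F2coeff-factor r v a a≤1+r {b₁} {b₂} w w′ pochb₁ pochb₂ = begin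
  (ρ * κ v w) * hyp3F2coeff (suc r) (ℕ→ℚ (suc r)) (ℕ→ℚ v + + 3 / 2) b₁ b₂ (+ 1 / 4) a
    ≡⟨ cong (ρ * κ v w *_) (hyp3F2coeff-split (suc r) (ℕ→ℚ (suc r)) (ℕ→ℚ v + + 3 / 2) b₁ b₂ (+ 1 / 4) a) ⟩
  (ρ * κ v w) * (X * Y)
    ≡⟨ interchange ρ (κ v w) X Y ⟩
  (ρ * X) * (κ v w * Y)
    ≡⟨ cong₂ _*_ (hyp3F2coeff-R-part r a a≤1+r pochb₁) (hyp3F2coeff-v-part v a w w′ pochb₂) ⟩
  _ ∎
  where
  ρ = ℕ→ℚ 1 ÷ ℕ→ℚ (suc r)
  X = (poch (- ℕ→ℚ (suc r)) a * poch (ℕ→ℚ (suc r)) a * (+ 1 / 4) ^ a) ÷ (ℕ→ℚ (a !) * poch b₁ a)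
  Y = poch (ℕ→ℚ v + + 3 / 2) a ÷ poch b₂ a

-- Integrals of polynomials over [0, 1]

∫₀¹-from-+ₚ : ∀ i p q → ∫₀¹-from i (p +ₚ q) ≡ ∫₀¹-from i p + ∫₀¹-from i q
∫₀¹-from-+ₚ i []      q       = sym (ℚₚ.+-identityˡ (∫₀¹-from i q))
∫₀¹-from-+ₚ i (a ∷ p) []      = sym (ℚₚ.+-identityʳ (∫₀¹-from i (a ∷ p)))
∫₀¹-from-+ₚ i (a ∷ p) (b ∷ q) = trans
  (cong₂ _+_ (ℚₚ.*-distribʳ-+ (inv (ℕ→ℚ (suc i))) a b) (∫₀¹-from-+ₚ (suc i) p q))
  (+-interchange (a ÷ ℕ→ℚ (suc i)) (b ÷ ℕ→ℚ (suc i)) (∫₀¹-from (suc i) p) (∫₀¹-from (suc i) q))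

∫₀¹-from-scaleₚ : ∀ i c p → ∫₀¹-from i (scaleₚ c p) ≡ c * ∫₀¹-from i p
∫₀¹-from-scaleₚ i c []      = sym (ℚₚ.*-zeroʳ c)
∫₀¹-from-scaleₚ i c (a ∷ p) = trans
  (cong₂ _+_ (ℚₚ.*-assoc c a (inv (ℕ→ℚ (suc i)))) (∫₀¹-from-scaleₚ (suc i) c p))
  (sym (ℚₚ.*-distribˡ-+ c (a ÷ ℕ→ℚ (suc i)) (∫₀¹-from (suc i) p)))

∫₀¹-from-xPow : ∀ n i → ∫₀¹-from i (xPow n) ≡ ℕ→ℚ 1 ÷ ℕ→ℚ (suc (n ℕ.+ i))
∫₀¹-from-xPow zero    i = ℚₚ.+-identityʳ (1ℚ ÷ ℕ→ℚ (suc i))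
∫₀¹-from-xPow (suc n) i = begin
  0ℚ ÷ ℕ→ℚ (suc i) + ∫₀¹-from (suc i) (xPow n)
    ≡⟨ cong₂ _+_ (ℚₚ.*-zeroˡ (inv (ℕ→ℚ (suc i)))) (∫₀¹-from-xPow n (suc i)) ⟩
  0ℚ + ℕ→ℚ 1 ÷ ℕ→ℚ (suc (n ℕ.+ suc i))
    ≡⟨ ℚₚ.+-identityˡ _ ⟩
  ℕ→ℚ 1 ÷ ℕ→ℚ (suc (n ℕ.+ suc i))
    ≡⟨ cong (λ k → ℕ→ℚ 1 ÷ ℕ→ℚ (suc k)) (ℕₚ.+-suc n i) ⟩
  ℕ→ℚ 1 ÷ ℕ→ℚ (suc (suc n ℕ.+ i)) ∎

∫₀¹-from-∷-*ₚ : ∀ i a p q → ∫₀¹-from i ((a ∷ p) *ₚ q) ≡ a * ∫₀¹-from i q + ∫₀¹-from (suc i) (p *ₚ q)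
∫₀¹-from-∷-*ₚ i a p q = begin
  ∫₀¹-from i (scaleₚ a q +ₚ (0ℚ ∷ (p *ₚ q)))
    ≡⟨ ∫₀¹-from-+ₚ i (scaleₚ a q) (0ℚ ∷ (p *ₚ q)) ⟩
  ∫₀¹-from i (scaleₚ a q) + (0ℚ ÷ ℕ→ℚ (suc i) + ∫₀¹-from (suc i) (p *ₚ q))
    ≡⟨ cong₂ _+_ (∫₀¹-from-scaleₚ i a q)
                 (trans (cong (_+ ∫₀¹-from (suc i) (p *ₚ q)) (ℚₚ.*-zeroˡ (inv (ℕ→ℚ (suc i)))))
                        (ℚₚ.+-identityˡ (∫₀¹-from (suc i) (p *ₚ q)))) ⟩
  a * ∫₀¹-from i q + ∫₀¹-from (suc i) (p *ₚ q) ∎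

∫₀¹-from-+ₚ-*ₚ : ∀ i p p′ q → ∫₀¹-from i ((p +ₚ p′) *ₚ q) ≡ ∫₀¹-from i (p *ₚ q) + ∫₀¹-from i (p′ *ₚ q)
∫₀¹-from-+ₚ-*ₚ i []      p′       q = sym (ℚₚ.+-identityˡ (∫₀¹-from i (p′ *ₚ q)))
∫₀¹-from-+ₚ-*ₚ i (a ∷ p) []       q = sym (ℚₚ.+-identityʳ (∫₀¹-from i ((a ∷ p) *ₚ q)))
∫₀¹-from-+ₚ-*ₚ i (a ∷ p) (b ∷ p′) q = begin
  ∫₀¹-from i (((a + b) ∷ (p +ₚ p′)) *ₚ q)
    ≡⟨ ∫₀¹-from-∷-*ₚ i (a + b) (p +ₚ p′) q ⟩
  (a + b) * ∫q + ∫₀¹-from (suc i) ((p +ₚ p′) *ₚ q)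
    ≡⟨ cong₂ _+_ (ℚₚ.*-distribʳ-+ ∫q a b) (∫₀¹-from-+ₚ-*ₚ (suc i) p p′ q) ⟩
  (a * ∫q + b * ∫q) + (∫₀¹-from (suc i) (p *ₚ q) + ∫₀¹-from (suc i) (p′ *ₚ q))
    ≡⟨ +-interchange (a * ∫q) (b * ∫q) (∫₀¹-from (suc i) (p *ₚ q)) (∫₀¹-from (suc i) (p′ *ₚ q)) ⟩
  (a * ∫q + ∫₀¹-from (suc i) (p *ₚ q)) + (b * ∫q + ∫₀¹-from (suc i) (p′ *ₚ q))
    ≡⟨ cong₂ _+_ (∫₀¹-from-∷-*ₚ i a p q) (∫₀¹-from-∷-*ₚ i b p′ q) ⟨
  ∫₀¹-from i ((a ∷ p) *ₚ q) + ∫₀¹-from i ((b ∷ p′) *ₚ q) ∎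
  where ∫q = ∫₀¹-from i q

∫₀¹-from-scaleₚ-*ₚ : ∀ i c p q → ∫₀¹-from i (scaleₚ c p *ₚ q) ≡ c * ∫₀¹-from i (p *ₚ q)
∫₀¹-from-scaleₚ-*ₚ i c []      q = sym (ℚₚ.*-zeroʳ c)
∫₀¹-from-scaleₚ-*ₚ i c (a ∷ p) q = begin
  ∫₀¹-from i (((c * a) ∷ scaleₚ c p) *ₚ q)
    ≡⟨ ∫₀¹-from-∷-*ₚ i (c * a) (scaleₚ c p) q ⟩
  (c * a) * ∫₀¹-from i q + ∫₀¹-from (suc i) (scaleₚ c p *ₚ q)
    ≡⟨ cong₂ _+_ (ℚₚ.*-assoc c a (∫₀¹-from i q)) (∫₀¹-from-scaleₚ-*ₚ (suc i) c p q) ⟩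
  c * (a * ∫₀¹-from i q) + c * ∫₀¹-from (suc i) (p *ₚ q)
    ≡⟨ ℚₚ.*-distribˡ-+ c _ _ ⟨
  c * (a * ∫₀¹-from i q + ∫₀¹-from (suc i) (p *ₚ q))
    ≡⟨ cong (c *_) (∫₀¹-from-∷-*ₚ i a p q) ⟨
  c * ∫₀¹-from i ((a ∷ p) *ₚ q) ∎

∫₀¹-from-xPow-*ₚ : ∀ n i q → ∫₀¹-from i (xPow n *ₚ q) ≡ ∫₀¹-from (n ℕ.+ i) q
∫₀¹-from-xPow-*ₚ zero    i q = trans (∫₀¹-from-∷-*ₚ i 1ℚ [] q)
  (trans (ℚₚ.+-identityʳ (1ℚ * ∫₀¹-from i q)) (ℚₚ.*-identityˡ (∫₀¹-from i q)))
∫₀¹-from-xPow-*ₚ (suc n) i q = begin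
  ∫₀¹-from i ((0ℚ ∷ xPow n) *ₚ q)
    ≡⟨ ∫₀¹-from-∷-*ₚ i 0ℚ (xPow n) q ⟩
  0ℚ * ∫₀¹-from i q + ∫₀¹-from (suc i) (xPow n *ₚ q)
    ≡⟨ cong₂ _+_ (ℚₚ.*-zeroˡ (∫₀¹-from i q)) (∫₀¹-from-xPow-*ₚ n (suc i) q) ⟩
  0ℚ + ∫₀¹-from (n ℕ.+ suc i) q
    ≡⟨ ℚₚ.+-identityˡ _ ⟩
  ∫₀¹-from (n ℕ.+ suc i) q
    ≡⟨ cong (λ k → ∫₀¹-from k q) (ℕₚ.+-suc n i) ⟩
  ∫₀¹-from (suc n ℕ.+ i) q ∎

∫₀¹-from-hyp3F2-upto-*ₚ : ∀ n f i q →
  ∫₀¹-from i (hyp3F2-upto n f *ₚ q) ≡ sumTo n (λ k → f k * ∫₀¹-from (k ℕ.+ i) q)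
∫₀¹-from-hyp3F2-upto-*ₚ zero    f i q = trans (∫₀¹-from-∷-*ₚ i (f 0) [] q) (ℚₚ.+-identityʳ _)
∫₀¹-from-hyp3F2-upto-*ₚ (suc n) f i q = begin
  ∫₀¹-from i ((hyp3F2-upto n f +ₚ scaleₚ (f (suc n)) (xPow (suc n))) *ₚ q)
    ≡⟨ ∫₀¹-from-+ₚ-*ₚ i (hyp3F2-upto n f) (scaleₚ (f (suc n)) (xPow (suc n))) q ⟩
  ∫₀¹-from i (hyp3F2-upto n f *ₚ q) + ∫₀¹-from i (scaleₚ (f (suc n)) (xPow (suc n)) *ₚ q)
    ≡⟨ cong₂ _+_ (∫₀¹-from-hyp3F2-upto-*ₚ n f i q)
                 (trans (∫₀¹-from-scaleₚ-*ₚ i (f (suc n)) (xPow (suc n)) q)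
                        (cong (f (suc n) *_) (∫₀¹-from-xPow-*ₚ (suc n) i q))) ⟩
  sumTo (suc n) (λ k → f k * ∫₀¹-from (k ℕ.+ i) q) ∎

∫₀¹-hyp3F2-upto-*ₚ-hyp3F2-upto-*ₚ-xPow : ∀ m n f g {k l} → suc k ≡ l →
  ∫₀¹ (hyp3F2-upto m f *ₚ (hyp3F2-upto n g *ₚ xPow k))
  ≡ sumTo m (λ a → f a * sumTo n (λ c → g c * (ℕ→ℚ 1 ÷ ℕ→ℚ (l ℕ.+ a ℕ.+ c))))
∫₀¹-hyp3F2-upto-*ₚ-hyp3F2-upto-*ₚ-xPow m n f g {k} refl =
  trans (∫₀¹-from-hyp3F2-upto-*ₚ m f 0 (hyp3F2-upto n g *ₚ xPow k)) (sumTo-cong m λ a _ →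
    cong (f a *_) (trans (∫₀¹-from-hyp3F2-upto-*ₚ n g (a ℕ.+ 0) (xPow k)) (sumTo-cong n λ c _ →
      cong (g c *_) (trans (∫₀¹-from-xPow k (c ℕ.+ (a ℕ.+ 0)))
                           (cong (λ i → ℕ→ℚ 1 ÷ ℕ→ℚ i) (reindex k a c))))))
  where
  reindex : ∀ k a c → suc (k ℕ.+ (c ℕ.+ (a ℕ.+ 0))) ≡ suc k ℕ.+ a ℕ.+ c
  reindex = ℕ-solve-∀

*-distribˡ-sumTo² : ∀ x m n (f g : ℕ → ℚ) (h : ℕ → ℕ → ℚ) →
  x * sumTo m (λ a → f a * sumTo n (λ c → g c * h a c))
  ≡ sumTo m (λ a → sumTo n (λ c → x * (f a * (g c * h a c))))
*-distribˡ-sumTo² x m n f g h = trans (*-distribˡ-sumTo x m _) (sumTo-cong m λ a _ →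
  trans (cong (x *_) (*-distribˡ-sumTo (f a) n _)) (*-distribˡ-sumTo x n _))

-- The double sum M₁

coeff₁ : (R v : ℕ) → ℕ → ℚ
coeff₁ R v = hyp3F2coeff R (ℕ→ℚ R) (ℕ→ℚ v + + 3 / 2) (+ 1 / 2) (ℕ→ℚ v + ℕ→ℚ 2) (+ 1 / 4)

coeff₂ : (R v : ℕ) → ℕ → ℚ
coeff₂ R v = hyp3F2coeff R (ℕ→ℚ R) (ℕ→ℚ v + + 3 / 2) (+ 3 / 2) (ℕ→ℚ v + ℕ→ℚ 1) (+ 1 / 4)

coeff₁-factor : ∀ r v a → a ≤ suc r →
  ((ℕ→ℚ 1 ÷ ℕ→ℚ (suc r)) * κ v (v ℕ.+ 1)) * coeff₁ (suc r) v a
  ≡ sign a * (ℕ→ℚ ((r ℕ.+ a) !) ÷ ℕ→ℚ ((2 ℕ.* a) ! ℕ.* (suc r ∸ a) !))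
      * (ℕ→ℚ ((2 ℕ.* v ℕ.+ 2 ℕ.* a ℕ.+ 1) !) ÷ ℕ→ℚ (2 ℕ.^ (2 ℕ.* v ℕ.+ 2 ℕ.* a) ℕ.* (v ℕ.+ a) ! ℕ.* (v ℕ.+ a ℕ.+ 1) !))
coeff₁-factor r v a a≤1+r =
  hyp3F2coeff-factor r v a a≤1+r (v ℕ.+ 1) (v ℕ.+ a ℕ.+ 1) (poch-½ a)
    (subst₂ (λ x k → poch x a ≐ k ! ⁄ (v ℕ.+ 1) !)
            (trans (cong ℕ→ℚ (sym (ℕₚ.+-suc v 1))) (ℕ→ℚ-homo-+ v 2)) (v+1+a≡v+a+1 v a)
            (poch-rising (v ℕ.+ 1) a))
  where
  v+1+a≡v+a+1 : ∀ v a → v ℕ.+ 1 ℕ.+ a ≡ v ℕ.+ a ℕ.+ 1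
  v+1+a≡v+a+1 = ℕ-solve-∀

coeff₂-factor : ∀ r v c → c ≤ suc r →
  ((ℕ→ℚ 1 ÷ ℕ→ℚ (suc r)) * κ v v) * coeff₂ (suc r) v c
  ≡ sign c * (ℕ→ℚ ((r ℕ.+ c) !) ÷ ℕ→ℚ ((2 ℕ.* c ℕ.+ 1) ! ℕ.* (suc r ∸ c) !))
      * (ℕ→ℚ ((2 ℕ.* v ℕ.+ 2 ℕ.* c ℕ.+ 1) !) ÷ ℕ→ℚ (2 ℕ.^ (2 ℕ.* v ℕ.+ 2 ℕ.* c) ℕ.* (v ℕ.+ c) ! ℕ.* (v ℕ.+ c) !))
coeff₂-factor r v c c≤1+r =
  hyp3F2coeff-factor r v c c≤1+r v (v ℕ.+ c)
    (subst₂ (λ n d → poch (+ 3 / 2) c ≐ n ⁄ d)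
            (ℕₚ.*-identityʳ ((2 ℕ.* c ℕ.+ 1) !)) (ℕₚ.*-identityʳ (4 ℕ.^ c ℕ.* c !)) (poch-3/2+m 0 c))
    (subst (λ x → poch x c ≐ (v ℕ.+ c) ! ⁄ v !)
           (trans (cong ℕ→ℚ (ℕₚ.+-comm 1 v)) (ℕ→ℚ-homo-+ v 1))
           (poch-rising v c))

prefactor : (R₁ R₂ v₁ v₂ : ℕ) → ℚ
prefactor R₁ R₂ v₁ v₂ =
  (ℕ→ℚ 1 ÷ ℕ→ℚ (R₁ ℕ.* R₂))
  * (ℕ→ℚ ((2 ℕ.* v₁ ℕ.+ 1) ! ℕ.* (2 ℕ.* v₂ ℕ.+ 1) !)
     ÷ ℕ→ℚ (2 ℕ.^ (2 ℕ.* v₁ ℕ.+ 2 ℕ.* v₂) ℕ.* v₁ ! ℕ.* (v₁ ℕ.+ 1) ! ℕ.* v₂ ! ℕ.* v₂ !))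

prefactor-split : ∀ R₁ R₂ v₁ v₂ →
  prefactor R₁ R₂ v₁ v₂ ≡ ((ℕ→ℚ 1 ÷ ℕ→ℚ R₁) * κ v₁ (v₁ ℕ.+ 1)) * ((ℕ→ℚ 1 ÷ ℕ→ℚ R₂) * κ v₂ v₂)
prefactor-split R₁ R₂ v₁ v₂ = begin
  prefactor R₁ R₂ v₁ v₂
    ≡⟨ ℕ→ℚ-÷-*-÷ 1 (R₁ ℕ.* R₂) (t₁ ℕ.* t₂) (2 ℕ.^ (2 ℕ.* v₁ ℕ.+ 2 ℕ.* v₂) ℕ.* v₁ ! ℕ.* (v₁ ℕ.+ 1) ! ℕ.* v₂ ! ℕ.* v₂ !) ⟩
  ℕ→ℚ (1 ℕ.* (t₁ ℕ.* t₂)) ÷ ℕ→ℚ (R₁ ℕ.* R₂ ℕ.* (2 ℕ.^ (2 ℕ.* v₁ ℕ.+ 2 ℕ.* v₂) ℕ.* v₁ ! ℕ.* (v₁ ℕ.+ 1) ! ℕ.* v₂ ! ℕ.* v₂ !))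
    ≡⟨ cong₂ (λ n d → ℕ→ℚ n ÷ ℕ→ℚ d) (num-split t₁ t₂)
         (trans (cong (λ p → R₁ ℕ.* R₂ ℕ.* (p ℕ.* v₁ ! ℕ.* (v₁ ℕ.+ 1) ! ℕ.* v₂ ! ℕ.* v₂ !))
                      (ℕₚ.^-distribˡ-+-* 2 (2 ℕ.* v₁) (2 ℕ.* v₂)))
                (den-split R₁ R₂ (2 ℕ.^ (2 ℕ.* v₁)) (2 ℕ.^ (2 ℕ.* v₂)) (v₁ !) ((v₁ ℕ.+ 1) !) (v₂ !))) ⟩
  ℕ→ℚ ((1 ℕ.* t₁) ℕ.* (1 ℕ.* t₂)) ÷ ℕ→ℚ ((R₁ ℕ.* d₁) ℕ.* (R₂ ℕ.* d₂))
    ≡⟨ ℕ→ℚ-÷-*-÷ (1 ℕ.* t₁) (R₁ ℕ.* d₁) (1 ℕ.* t₂) (R₂ ℕ.* d₂) ⟨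
  (ℕ→ℚ (1 ℕ.* t₁) ÷ ℕ→ℚ (R₁ ℕ.* d₁)) * (ℕ→ℚ (1 ℕ.* t₂) ÷ ℕ→ℚ (R₂ ℕ.* d₂))
    ≡⟨ cong₂ _*_ (ℕ→ℚ-÷-*-÷ 1 R₁ t₁ d₁) (ℕ→ℚ-÷-*-÷ 1 R₂ t₂ d₂) ⟨
  ((ℕ→ℚ 1 ÷ ℕ→ℚ R₁) * κ v₁ (v₁ ℕ.+ 1)) * ((ℕ→ℚ 1 ÷ ℕ→ℚ R₂) * κ v₂ v₂) ∎
  where
  t₁ = (2 ℕ.* v₁ ℕ.+ 1) !
  t₂ = (2 ℕ.* v₂ ℕ.+ 1) !
  d₁ = 2 ℕ.^ (2 ℕ.* v₁) ℕ.* v₁ ! ℕ.* (v₁ ℕ.+ 1) !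
  d₂ = 2 ℕ.^ (2 ℕ.* v₂) ℕ.* v₂ ! ℕ.* v₂ !
  num-split : ∀ t₁ t₂ → 1 ℕ.* (t₁ ℕ.* t₂) ≡ (1 ℕ.* t₁) ℕ.* (1 ℕ.* t₂)
  num-split = ℕ-solve-∀
  den-split : ∀ R₁ R₂ p₁ p₂ x y z →
    R₁ ℕ.* R₂ ℕ.* (p₁ ℕ.* p₂ ℕ.* x ℕ.* y ℕ.* z ℕ.* z) ≡ (R₁ ℕ.* (p₁ ℕ.* x ℕ.* y)) ℕ.* (R₂ ℕ.* (p₂ ℕ.* z ℕ.* z))
  den-split = ℕ-solve-∀

Mterm≡ : ∀ r₁ r₂ v₁ v₂ {a c} → a ≤ suc r₁ → c ≤ suc r₂ →
  Mterm v₁ v₂ (suc r₁) (suc r₂) (λ _ _ → 1ℚ) a c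
  ≡ prefactor (suc r₁) (suc r₂) v₁ v₂
    * (coeff₁ (suc r₁) v₁ a * (coeff₂ (suc r₂) v₂ c * (ℕ→ℚ 1 ÷ ℕ→ℚ (u v₁ v₂ ℕ.+ a ℕ.+ c))))
Mterm≡ r₁ r₂ v₁ v₂ {a} {c} a≤1+r₁ c≤1+r₂ = begin
  sign (a ℕ.+ c) * A * B * V₁ * V₂ * W
    ≡⟨ cong (λ s → s * A * B * V₁ * V₂ * W) (^-distribˡ-+-* (- 1ℚ) a c) ⟩
  sign a * sign c * A * B * V₁ * V₂ * W
    ≡⟨ regroup₁ (sign a) (sign c) A B V₁ V₂ W ⟩
  (sign a * A * V₁) * (sign c * B * V₂) * W
    ≡⟨ cong₂ (λ x y → x * y * W) (coeff₁-factor r₁ v₁ a a≤1+r₁) (coeff₂-factor r₂ v₂ c c≤1+r₂) ⟨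
  (ρκ₁ * coeff₁ (suc r₁) v₁ a) * (ρκ₂ * coeff₂ (suc r₂) v₂ c) * W
    ≡⟨ regroup₂ ρκ₁ (coeff₁ (suc r₁) v₁ a) ρκ₂ (coeff₂ (suc r₂) v₂ c) W ⟩
  (ρκ₁ * ρκ₂) * (coeff₁ (suc r₁) v₁ a * (coeff₂ (suc r₂) v₂ c * W))
    ≡⟨ cong (_* (coeff₁ (suc r₁) v₁ a * (coeff₂ (suc r₂) v₂ c * W))) (prefactor-split (suc r₁) (suc r₂) v₁ v₂) ⟨
  prefactor (suc r₁) (suc r₂) v₁ v₂ * (coeff₁ (suc r₁) v₁ a * (coeff₂ (suc r₂) v₂ c * W)) ∎
  where
  A = ℕ→ℚ ((r₁ ℕ.+ a) !) ÷ ℕ→ℚ ((2 ℕ.* a) ! ℕ.* (suc r₁ ∸ a) !)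
  B = ℕ→ℚ ((r₂ ℕ.+ c) !) ÷ ℕ→ℚ ((2 ℕ.* c ℕ.+ 1) ! ℕ.* (suc r₂ ∸ c) !)
  V₁ = ℕ→ℚ ((2 ℕ.* v₁ ℕ.+ 2 ℕ.* a ℕ.+ 1) !)
       ÷ ℕ→ℚ (2 ℕ.^ (2 ℕ.* v₁ ℕ.+ 2 ℕ.* a) ℕ.* (v₁ ℕ.+ a) ! ℕ.* (v₁ ℕ.+ a ℕ.+ 1) !)
  V₂ = ℕ→ℚ ((2 ℕ.* v₂ ℕ.+ 2 ℕ.* c ℕ.+ 1) !)
       ÷ ℕ→ℚ (2 ℕ.^ (2 ℕ.* v₂ ℕ.+ 2 ℕ.* c) ℕ.* (v₂ ℕ.+ c) ! ℕ.* (v₂ ℕ.+ c) !)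
  W = ℕ→ℚ 1 ÷ ℕ→ℚ (u v₁ v₂ ℕ.+ a ℕ.+ c)
  ρκ₁ = (ℕ→ℚ 1 ÷ ℕ→ℚ (suc r₁)) * κ v₁ (v₁ ℕ.+ 1)
  ρκ₂ = (ℕ→ℚ 1 ÷ ℕ→ℚ (suc r₂)) * κ v₂ v₂
  regroup₁ : ∀ s t a b x y w → s * t * a * b * x * y * w ≡ (s * a * x) * (t * b * y) * w
  regroup₁ = solve-∀ ℚ-ring
  regroup₂ : ∀ p f q g w → (p * f) * (q * g) * w ≡ (p * q) * (f * (g * w))
  regroup₂ = solve-∀ ℚ-ring

proposition3p1 : (R₁ R₂ v₁ v₂ : ℕ) → R₁ ≥ 1 → R₂ ≥ 1 →
    M₁ v₁ v₂ R₁ R₂ ≡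
      (ℕ→ℚ 1 ÷ ℕ→ℚ (R₁ Data.Nat.* R₂))
      * (ℕ→ℚ ((2 Data.Nat.* v₁ Data.Nat.+ 1) ! Data.Nat.* (2 Data.Nat.* v₂ Data.Nat.+ 1) !)
         ÷ ℕ→ℚ (2 Data.Nat.^ (2 Data.Nat.* v₁ Data.Nat.+ 2 Data.Nat.* v₂) Data.Nat.* v₁ ! Data.Nat.* (v₁ Data.Nat.+ 1) ! Data.Nat.* v₂ ! Data.Nat.* v₂ !))
      * ∫₀¹ (hyp3F2ₓ R₁ (ℕ→ℚ R₁) (ℕ→ℚ v₁ + (+ 3 / 2)) (+ 1 / 2) (ℕ→ℚ v₁ + ℕ→ℚ 2) (+ 1 / 4)
             *ₚ (hyp3F2ₓ R₂ (ℕ→ℚ R₂) (ℕ→ℚ v₂ + (+ 3 / 2)) (+ 3 / 2) (ℕ→ℚ v₂ + ℕ→ℚ 1) (+ 1 / 4)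
             *ₚ xPow (u v₁ v₂ ∸ 1)))
proposition3p1 (suc r₁) (suc r₂) v₁ v₂ (ℕ.s≤s ℕ.z≤n) (ℕ.s≤s ℕ.z≤n) = begin
  M₁ v₁ v₂ R₁ R₂
    ≡⟨ sumTo-cong R₁ (λ a a≤R₁ → sumTo-cong R₂ (λ c c≤R₂ → Mterm≡ r₁ r₂ v₁ v₂ a≤R₁ c≤R₂)) ⟩
  sumTo R₁ (λ a → sumTo R₂ (λ c → P * (f₁ a * (f₂ c * W a c))))
    ≡⟨ *-distribˡ-sumTo² P R₁ R₂ f₁ f₂ W ⟨
  P * sumTo R₁ (λ a → f₁ a * sumTo R₂ (λ c → f₂ c * W a c))
    ≡⟨ cong (P *_) (∫₀¹-hyp3F2-upto-*ₚ-hyp3F2-upto-*ₚ-xPow R₁ R₂ f₁ f₂ 1+[u∸1]≡u) ⟨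
  P * ∫₀¹ (hyp3F2-upto R₁ f₁ *ₚ (hyp3F2-upto R₂ f₂ *ₚ xPow (u v₁ v₂ ∸ 1))) ∎
  where
  R₁ = suc r₁
  R₂ = suc r₂
  P = prefactor R₁ R₂ v₁ v₂
  f₁ = coeff₁ R₁ v₁
  f₂ = coeff₂ R₂ v₂
  W : ℕ → ℕ → ℚ
  W a c = ℕ→ℚ 1 ÷ ℕ→ℚ (u v₁ v₂ ℕ.+ a ℕ.+ c)
  1+[u∸1]≡u : suc (u v₁ v₂ ∸ 1) ≡ u v₁ v₂
  1+[u∸1]≡u = trans (cong (λ n → suc (n ∸ 1)) (ℕₚ.+-comm (v₁ ℕ.+ v₂) 2)) (ℕₚ.+-comm 2 (v₁ ℕ.+ v₂))
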